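{- Let $n,M$ be positive integers. Consider the randomized algorithm which, given an affine subspace $V\subseteq\mathbb F_2^n$ and an integer $a$, samples $T$ independent uniformly random points of $V$, outputs one of them whose Hamming weight is $\equiv a\pmod M$ if any exists, and otherwise outputs NO-SOLUTION. If $T\ge 4\cdot 2^{\mathcal D(n,M)}$, then on every input this algorithm outputs correctly (a point $x\in V$ with $\mathsf{Ham}(x)\equiv a\pmod M$ if such a point exists, NO-SOLUTION otherwise) with probability at least $2/3$.
   Context: $\mathsf{Ham}(x)$ is the Hamming weight of $x\in\mathbb F_2^n$. $\mathcal D(n,M)$ denotes the largest dimension of an affine subspace $C$ of $\mathbb F_2^n$ such that for some $0\le a\le M$ there exists exactly one point $x_0\in C$ with $\mathsf{Ham}(x_0)\equiv a\pmod M$. (The solution set of a system of linear equations over $\mathbb F_2$ with a global Hamming-weight constraint mod $M$ is the input to this problem, i.e. $\mathsf{LIN\text{ - }2\text{ - }MOD}_M(n)$.) -}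

module Defs where

open import Data.Bool using (Bool; true; false; _xor_; _∧_; not; if_then_else_)
open import Data.Nat using (ℕ; zero; suc; _+_; _*_; _^_; _≤_)
open import Data.Integer as ℤ using (ℤ; +_; _-_)
open import Data.Integer.Divisibility using (_∣_)
open import Data.Integer.DivMod using ()
open import Data.List using (List; []; _∷_; concatMap; map)
open import Data.Bool.ListAction using (any)
open import Data.Vec using (Vec; []; _∷_; zipWith; replicate)
open import Data.Vec.Properties using (≡-dec)
open import Data.Maybe using (Maybe; just; nothing)
open import Data.Product using (Σ; _×_; _,_; ∃)
open import Relation.Binary.PropositionalEquality using (_≡_)
open import Relation.Nullary.Decidable using (⌊_⌋)
import Data.Bool.Properties as BoolP
import Data.Integer.Divisibility.Signed as ℤDiv

-- The vector space F₂ⁿ, with Bool as F₂ (true = 1, xor = addition).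
F₂^ : ℕ → Set
F₂^ n = Vec Bool n

zeroV : ∀ {n} → F₂^ n
zeroV = replicate _ false

_⊕_ : ∀ {n} → F₂^ n → F₂^ n → F₂^ n
_⊕_ = zipWith _xor_

_·_ : ∀ {n} → Bool → F₂^ n → F₂^ n
true  · x = x
false · x = zeroV

Ham : ∀ {n} → F₂^ n → ℕ
Ham []          = 0
Ham (true ∷ x)  = suc (Ham x)
Ham (false ∷ x) = Ham x

lincomb : ∀ {n d} → Vec (F₂^ n) d → F₂^ d → F₂^ n
lincomb []       []       = zeroV
lincomb (b ∷ bs) (c ∷ cs) = (c · b) ⊕ lincomb bs cs

LinIndep : ∀ {n d} → Vec (F₂^ n) d → Set
LinIndep b = ∀ c c′ → lincomb b c ≡ lincomb b c′ → c ≡ c′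

-- An affine subspace of F₂ⁿ of dimension d, presented as x₀ + span(b)
-- with b a basis (a linearly independent family of d vectors) of the direction.
record AffSub (n d : ℕ) : Set where
  constructor affSub
  field
    base  : F₂^ n
    basis : Vec (F₂^ n) d
    indep : LinIndep basis

-- The point of C with coordinates c ∈ F₂ᵈ (a bijection F₂ᵈ → C).
point : ∀ {n d} → AffSub n d → F₂^ d → F₂^ n
point C c = AffSub.base C ⊕ lincomb (AffSub.basis C) c

_∈A_ : ∀ {n d} → F₂^ n → AffSub n d → Set
x ∈A C = ∃ λ c → point C c ≡ x

HamCong : ∀ {n} → ℕ → ℤ → F₂^ n → Set
HamCong M a x = (+ M) ∣ ((+ Ham x) - a)

ExactlyOne : ∀ {n d} → ℕ → ℤ → AffSub n d → Set
ExactlyOne M a C =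
  Σ (F₂^ _) λ x → (x ∈A C × HamCong M a x) ×
    (∀ y → y ∈A C → HamCong M a y → y ≡ x)

-- 𝒟(n,M) = D : D is the largest dimension of an affine subspace C of F₂ⁿ
-- such that for some 0 ≤ a ≤ M exactly one point x₀ ∈ C has Ham(x₀) ≡ a (mod M).
IsDmax : ℕ → ℕ → ℕ → Set
IsDmax n M D =
  (Σ (AffSub n D) λ C → Σ ℕ λ a → a ≤ M × ExactlyOne M (+ a) C) ×
  (∀ d (C : AffSub n d) (a : ℕ) → a ≤ M → ExactlyOne M (+ a) C → d ≤ D)

allVecs : (k : ℕ) → List (F₂^ k)
allVecs zero    = [] ∷ []
allVecs (suc k) = concatMap (λ v → (false ∷ v) ∷ (true ∷ v) ∷ []) (allVecs k)

allTuples : ∀ {A : Set} → List A → (T : ℕ) → List (Vec A T)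
allTuples xs zero    = [] ∷ []
allTuples xs (suc T) = concatMap (λ x → map (x ∷_) (allTuples xs T)) xs

hamCong? : ∀ {n} → ℕ → ℤ → F₂^ n → Bool
hamCong? M a x = ⌊ (+ M) ℤDiv.∣? ((+ Ham x) - a) ⌋

-- Algorithm output on sampled points: one of the samples of weight ≡ a (mod M)
-- (the first such one) if any, otherwise NO-SOLUTION (= nothing).
firstGood : ∀ {n T} → ℕ → ℤ → Vec (F₂^ n) T → Maybe (F₂^ n)
firstGood M a []       = nothing
firstGood M a (x ∷ xs) = if hamCong? M a x then just x else firstGood M a xs

-- The T samples, given as coordinate vectors (uniform points of C
-- correspond bijectively to uniform coordinate vectors in F₂ᵈ).
algorithm : ∀ {n d T} → ℕ → AffSub n d → ℤ → Vec (F₂^ d) T → Maybe (F₂^ n)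
algorithm M C a s = firstGood M a (Data.Vec.map (point C) s)

mem? : ∀ {n d} → AffSub n d → F₂^ n → Bool
mem? {d = d} C x = any (λ c → ⌊ ≡-dec BoolP._≟_ (point C c) x ⌋) (allVecs d)

hasSol? : ∀ {n d} → ℕ → AffSub n d → ℤ → Bool
hasSol? {d = d} M C a = any (λ c → hamCong? M a (point C c)) (allVecs d)

correct? : ∀ {n d} → ℕ → AffSub n d → ℤ → Maybe (F₂^ n) → Bool
correct? M C a (just x) = mem? C x ∧ hamCong? M a x
correct? M C a nothing  = not (hasSol? M C a)

countTrue : List Bool → ℕ
countTrue []           = 0
countTrue (true ∷ bs)  = suc (countTrue bs)
countTrue (false ∷ bs) = countTrue bs

-- Number of sample tuples (out of the (2^d)^T equally likely ones) on which
-- the algorithm is correct.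
numCorrect : ∀ {n d} → ℕ → AffSub n d → ℤ → (T : ℕ) → ℕ
numCorrect {d = d} M C a T =
  countTrue (map (λ s → correct? M C a (algorithm M C a s)) (allTuples (allVecs d) T))

-- Let S ⊆ F₂ᵈ be the coordinates of the solutions in V. If S is empty, every run answers
-- NO-SOLUTION correctly. Otherwise, going through the coordinates of F₂ᵈ one at a time, we
-- fix a coordinate to the side holding the smaller nonempty half of S, or leave it free when
-- one side holds none of S; this yields an affine subspace K of F₂ᵈ with |K ∩ S| = 1 and
-- 2ᵈ ≤ |S| · 2^(dim K). The image of K in V is an affine subspace of F₂ⁿ with exactly one
-- solution, so dim K ≤ 𝒟 and a uniform sample is a solution with probability ≥ 2^(−𝒟).
-- Hence T ≥ 4 · 2^𝒟 samples all miss with probability ≤ (1 − 2^(−𝒟))^(2 · 2^𝒟) ≤ 1/4,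
-- by (1 + 1/m)^(m+1) ≥ 2.

module Submission where

open import Defs
open import Data.Nat using (ℕ; _*_; _^_; _≤_)
open import Data.Integer using (ℤ)

open import Algebra.Bundles using (CommutativeSemigroup)
open import Data.Bool using (Bool; true; false; _xor_; _∧_; _∨_; not; if_then_else_)
import Data.Bool as Bool using (_≟_)
open import Data.Bool.ListAction using (any; all)
open import Data.Bool.Properties
  using (T-≡; ¬-not; ∨-zeroʳ; ∨-identityʳ; xor-assoc; xor-comm; xor-same; xor-identityˡ; xor-identityʳ)
import Data.Integer as ℤ
open import Data.Integer.DivMod using (_%ℕ_; _/ℕ_; a≡a%ℕn+[a/ℕn]*n; n%ℕd<d)
open import Data.Integer using (_-_)
open import Data.Integer.Divisibility.Signed using (_∣_; divides; ∣m∣n⇒∣m+n; ∣ᵤ⇒∣; ∣⇒∣ᵤ; _∣?_)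
open import Data.Integer.Properties using (+-minus-telescope)
import Data.Integer.Tactic.RingSolver as ℤ-Solver
open import Data.List as List using (List; []; _∷_; _++_; length; concatMap)
open import Data.List.Membership.Propositional using (_∈_)
open import Data.List.Membership.Propositional.Properties using (∈-concatMap⁺)
open import Data.List.Properties using (map-++; map-cong; map-∘; length-++; length-map)
open import Data.List.Relation.Unary.Any as Any using (here; there)
open import Data.Nat using (zero; suc; _+_; _∸_; NonZero; z≤n; s≤s)
open import Data.Nat.Properties
open import Data.Nat.Tactic.RingSolver using (solve-∀)
open import Algebra.Properties.CommutativeSemigroup *-commutativeSemigroup
  using (x∙yz≈y∙xz) renaming (interchange to *-interchange)
open import Data.Product using (_,_)
open import Data.Vec using (Vec; []; _∷_; map; toList)
open import Data.Vec.Properties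
  using (≡-dec; zipWith-assoc; zipWith-comm; zipWith-identityˡ; zipWith-identityʳ; ∷-injective; ∷-injectiveʳ)
open import Function using (_∘_)
open import Function.Bundles using (Equivalence)
open import Relation.Binary.PropositionalEquality
  using (_≡_; refl; sym; trans; cong; cong₂; subst; module ≡-Reasoning)
open import Relation.Binary.PropositionalEquality.Algebra using (isMagma)
open import Relation.Nullary using (Dec; yes; no)
open import Relation.Nullary.Decidable using (⌊_⌋; isYes≗does; dec-true; toWitness)

⊕-assoc : ∀ {n} (x y z : F₂^ n) → (x ⊕ y) ⊕ z ≡ x ⊕ (y ⊕ z)
⊕-assoc = zipWith-assoc xor-assoc

⊕-comm : ∀ {n} (x y : F₂^ n) → x ⊕ y ≡ y ⊕ x
⊕-comm = zipWith-comm xor-comm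

⊕-identityˡ : ∀ {n} (x : F₂^ n) → zeroV ⊕ x ≡ x
⊕-identityˡ = zipWith-identityˡ xor-identityˡ

⊕-identityʳ : ∀ {n} (x : F₂^ n) → x ⊕ zeroV ≡ x
⊕-identityʳ = zipWith-identityʳ xor-identityʳ

⊕-self : ∀ {n} (x : F₂^ n) → x ⊕ x ≡ zeroV
⊕-self []      = refl
⊕-self (b ∷ x) = cong₂ _∷_ (xor-same b) (⊕-self x)

⊕-commutativeSemigroup : ℕ → CommutativeSemigroup _ _
⊕-commutativeSemigroup n = record
  { isCommutativeSemigroup = record
    { isSemigroup = record { isMagma = isMagma (_⊕_ {n}) ; assoc = ⊕-assoc }
    ; comm        = ⊕-comm
    }
  }

⊕-interchange : ∀ {n} (w x y z : F₂^ n) → (w ⊕ x) ⊕ (y ⊕ z) ≡ (w ⊕ y) ⊕ (x ⊕ z)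
⊕-interchange {n} = interchange
  where open import Algebra.Properties.CommutativeSemigroup (⊕-commutativeSemigroup n) using (interchange)

·-distribʳ-xor : ∀ {n} (β γ : Bool) (x : F₂^ n) → (β xor γ) · x ≡ (β · x) ⊕ (γ · x)
·-distribʳ-xor true  true  x = sym (⊕-self x)
·-distribʳ-xor true  false x = sym (⊕-identityʳ x)
·-distribʳ-xor false γ     x = sym (⊕-identityˡ (γ · x))

lincomb-zero : ∀ {n d} (bs : Vec (F₂^ n) d) → lincomb bs zeroV ≡ zeroV
lincomb-zero []       = refl
lincomb-zero (b ∷ bs) = trans (⊕-identityˡ (lincomb bs zeroV)) (lincomb-zero bs)

lincomb-⊕ : ∀ {n d} (bs : Vec (F₂^ n) d) (c c′ : F₂^ d) →
  lincomb bs (c ⊕ c′) ≡ lincomb bs c ⊕ lincomb bs c′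
lincomb-⊕ []       []       []         = sym (⊕-self zeroV)
lincomb-⊕ (b ∷ bs) (β ∷ c)  (β′ ∷ c′) = begin
  ((β xor β′) · b) ⊕ lincomb bs (c ⊕ c′)
    ≡⟨ cong₂ _⊕_ (·-distribʳ-xor β β′ b) (lincomb-⊕ bs c c′) ⟩
  ((β · b) ⊕ (β′ · b)) ⊕ (lincomb bs c ⊕ lincomb bs c′)
    ≡⟨ ⊕-interchange (β · b) (β′ · b) (lincomb bs c) (lincomb bs c′) ⟩
  ((β · b) ⊕ lincomb bs c) ⊕ ((β′ · b) ⊕ lincomb bs c′) ∎
  where open ≡-Reasoning

lincomb-· : ∀ {n d} (bs : Vec (F₂^ n) d) (β : Bool) (c : F₂^ d) →
  lincomb bs (β · c) ≡ β · lincomb bs c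
lincomb-· bs true  c = refl
lincomb-· bs false c = lincomb-zero bs

lincomb-map-lincomb : ∀ {n d k} (bs : Vec (F₂^ n) d) (es : Vec (F₂^ d) k) (c : F₂^ k) →
  lincomb (map (lincomb bs) es) c ≡ lincomb bs (lincomb es c)
lincomb-map-lincomb bs []       []      = sym (lincomb-zero bs)
lincomb-map-lincomb bs (e ∷ es) (β ∷ c) = begin
  (β · lincomb bs e) ⊕ lincomb (map (lincomb bs) es) c
    ≡⟨ cong₂ _⊕_ (sym (lincomb-· bs β e)) (lincomb-map-lincomb bs es c) ⟩
  lincomb bs (β · e) ⊕ lincomb bs (lincomb es c)
    ≡⟨ lincomb-⊕ bs (β · e) (lincomb es c) ⟨
  lincomb bs ((β · e) ⊕ lincomb es c) ∎
  where open ≡-Reasoning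

restrict : ∀ {n d k} → AffSub n d → AffSub d k → AffSub n k
restrict V K = affSub (point V (base K)) (map (lincomb (basis V)) (basis K)) independent
  where
  open AffSub
  independent : LinIndep (map (lincomb (basis V)) (basis K))
  independent c c′ eq = indep K c c′ (indep V _ _ (begin
    lincomb (basis V) (lincomb (basis K) c)         ≡⟨ lincomb-map-lincomb (basis V) (basis K) c ⟨
    lincomb (map (lincomb (basis V)) (basis K)) c  ≡⟨ eq ⟩
    lincomb (map (lincomb (basis V)) (basis K)) c′ ≡⟨ lincomb-map-lincomb (basis V) (basis K) c′ ⟩
    lincomb (basis V) (lincomb (basis K) c′)        ∎))
    where open ≡-Reasoning

point-restrict : ∀ {n d k} (V : AffSub n d) (K : AffSub d k) (c : F₂^ k) →
  point (restrict V K) c ≡ point V (point K c)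
point-restrict (affSub x₀ bs _) (affSub y₀ es _) c = begin
  (x₀ ⊕ lincomb bs y₀) ⊕ lincomb (map (lincomb bs) es) c
    ≡⟨ cong (_ ⊕_) (lincomb-map-lincomb bs es c) ⟩
  (x₀ ⊕ lincomb bs y₀) ⊕ lincomb bs (lincomb es c)
    ≡⟨ ⊕-assoc x₀ _ _ ⟩
  x₀ ⊕ (lincomb bs y₀ ⊕ lincomb bs (lincomb es c))
    ≡⟨ cong (x₀ ⊕_) (lincomb-⊕ bs y₀ (lincomb es c)) ⟨
  x₀ ⊕ lincomb bs (y₀ ⊕ lincomb es c) ∎
  where open ≡-Reasoning

lincomb-map-false∷ : ∀ {d k} (es : Vec (F₂^ d) k) (c : F₂^ k) →
  lincomb (map (false ∷_) es) c ≡ false ∷ lincomb es c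
lincomb-map-false∷ []       []           = refl
lincomb-map-false∷ (e ∷ es) (true ∷ c)  = cong ((false ∷ e) ⊕_) (lincomb-map-false∷ es c)
lincomb-map-false∷ (e ∷ es) (false ∷ c) = cong (zeroV ⊕_) (lincomb-map-false∷ es c)

fixHead : ∀ {d k} → Bool → AffSub d k → AffSub (suc d) k
fixHead b (affSub y₀ es indep) = affSub (b ∷ y₀) (map (false ∷_) es) independent
  where
  independent : LinIndep (map (false ∷_) es)
  independent c c′ eq = indep c c′ (∷-injectiveʳ (begin
    false ∷ lincomb es c          ≡⟨ lincomb-map-false∷ es c ⟨
    lincomb (map (false ∷_) es) c  ≡⟨ eq ⟩
    lincomb (map (false ∷_) es) c′ ≡⟨ lincomb-map-false∷ es c′ ⟩
    false ∷ lincomb es c′          ∎))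
    where open ≡-Reasoning

point-fixHead : ∀ {d k} (b : Bool) (K : AffSub d k) (c : F₂^ k) →
  point (fixHead b K) c ≡ b ∷ point K c
point-fixHead b (affSub y₀ es _) c =
  trans (cong ((b ∷ y₀) ⊕_) (lincomb-map-false∷ es c)) (cong (_∷ _) (xor-identityʳ b))

freeHeadBasis : ∀ {d k} → Vec (F₂^ d) k → Vec (F₂^ (suc d)) (suc k)
freeHeadBasis es = (true ∷ zeroV) ∷ map (false ∷_) es

lincomb-freeHeadBasis : ∀ {d k} (es : Vec (F₂^ d) k) (β : Bool) (c : F₂^ k) →
  lincomb (freeHeadBasis es) (β ∷ c) ≡ β ∷ lincomb es c
lincomb-freeHeadBasis es true  c =
  trans (cong ((true ∷ zeroV) ⊕_) (lincomb-map-false∷ es c)) (cong (true ∷_) (⊕-identityˡ _))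
lincomb-freeHeadBasis es false c =
  trans (cong (zeroV ⊕_) (lincomb-map-false∷ es c)) (cong (false ∷_) (⊕-identityˡ _))

freeHead : ∀ {d k} → AffSub d k → AffSub (suc d) (suc k)
freeHead (affSub y₀ es indep) = affSub (false ∷ y₀) (freeHeadBasis es) independent
  where
  independent : LinIndep (freeHeadBasis es)
  independent (β ∷ c) (β′ ∷ c′) eq with ∷-injective (begin
    β ∷ lincomb es c                   ≡⟨ lincomb-freeHeadBasis es β c ⟨
    lincomb (freeHeadBasis es) (β ∷ c)   ≡⟨ eq ⟩
    lincomb (freeHeadBasis es) (β′ ∷ c′) ≡⟨ lincomb-freeHeadBasis es β′ c′ ⟩
    β′ ∷ lincomb es c′                 ∎)
    where open ≡-Reasoning
  ... | β≡β′ , lc≡lc′ = cong₂ _∷_ β≡β′ (indep c c′ lc≡lc′)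

point-freeHead : ∀ {d k} (K : AffSub d k) (β : Bool) (c : F₂^ k) →
  point (freeHead K) (β ∷ c) ≡ β ∷ point K c
point-freeHead (affSub y₀ es _) β c = cong ((false ∷ y₀) ⊕_) (lincomb-freeHeadBasis es β c)

-- Isolating one point of a subset of the cube

count : ∀ {d} → (F₂^ d → Bool) → ℕ
count {zero}  g = if g [] then 1 else 0
count {suc d} g = count (g ∘ (false ∷_)) + count (g ∘ (true ∷_))

count≡0⇒false : ∀ {d} (g : F₂^ d → Bool) → count g ≡ 0 → ∀ c → g c ≡ false
count≡0⇒false {zero} g g0 [] with g []
... | false = refl
count≡0⇒false {suc d} g g0 (false ∷ c) =
  count≡0⇒false (g ∘ (false ∷_)) (m+n≡0⇒m≡0 _ g0) c
count≡0⇒false {suc d} g g0 (true ∷ c) =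
  count≡0⇒false (g ∘ (true ∷_)) (m+n≡0⇒n≡0 (count (g ∘ (false ∷_))) g0) c

record IsolatingSubspace {d} (g : F₂^ d → Bool) : Set where
  field
    {dim}    : ℕ
    subspace : AffSub d dim
    centre   : F₂^ dim
    centre∈  : g (point subspace centre) ≡ true
    unique   : ∀ c → g (point subspace c) ≡ true → point subspace c ≡ point subspace centre
    large    : 2 ^ d ≤ count g * 2 ^ dim

isolating-fixHead : ∀ {d} (g : F₂^ (suc d) → Bool) (b : Bool) →
  2 * count (g ∘ (b ∷_)) ≤ count g →
  IsolatingSubspace (g ∘ (b ∷_)) → IsolatingSubspace g
isolating-fixHead {d} g b half I = record
  { subspace = fixHead b subspace
  ; centre   = centre
  ; centre∈  = subst (λ x → g x ≡ true) (sym (point-fixHead b subspace centre)) centre∈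
  ; unique   = unique′
  ; large    = begin
      2 * 2 ^ d                          ≤⟨ *-monoʳ-≤ 2 large ⟩
      2 * (count (g ∘ (b ∷_)) * 2 ^ dim) ≡⟨ *-assoc 2 (count (g ∘ (b ∷_))) (2 ^ dim) ⟨
      2 * count (g ∘ (b ∷_)) * 2 ^ dim   ≤⟨ *-monoˡ-≤ (2 ^ dim) half ⟩
      count g * 2 ^ dim                  ∎
  }
  where
  open IsolatingSubspace I
  open ≤-Reasoning
  unique′ : ∀ c → g (point (fixHead b subspace) c) ≡ true →
            point (fixHead b subspace) c ≡ point (fixHead b subspace) centre
  unique′ c gc rewrite point-fixHead b subspace c | point-fixHead b subspace centre =
    cong (b ∷_) (unique c gc)

isolating-freeHead : ∀ {d} (g : F₂^ (suc d) → Bool) (b : Bool) →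
  (∀ v → g (not b ∷ v) ≡ false) → count (g ∘ (b ∷_)) ≤ count g →
  IsolatingSubspace (g ∘ (b ∷_)) → IsolatingSubspace g
isolating-freeHead {d} g b other-empty ≤count I = record
  { subspace = freeHead subspace
  ; centre   = b ∷ centre
  ; centre∈  = subst (λ x → g x ≡ true) (sym (point-freeHead subspace b centre)) centre∈
  ; unique   = unique′
  ; large    = begin
      2 * 2 ^ d                          ≤⟨ *-monoʳ-≤ 2 large ⟩
      2 * (count (g ∘ (b ∷_)) * 2 ^ dim) ≡⟨ x∙yz≈y∙xz 2 (count (g ∘ (b ∷_))) (2 ^ dim) ⟩
      count (g ∘ (b ∷_)) * 2 ^ suc dim   ≤⟨ *-monoˡ-≤ (2 ^ suc dim) ≤count ⟩
      count g * 2 ^ suc dim              ∎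
  }
  where
  open IsolatingSubspace I
  open ≤-Reasoning
  unique′ : ∀ c → g (point (freeHead subspace) c) ≡ true →
            point (freeHead subspace) c ≡ point (freeHead subspace) (b ∷ centre)
  unique′ (β ∷ c) gc rewrite point-freeHead subspace β c | point-freeHead subspace b centre
    with β Bool.≟ b
  ... | yes refl = cong (b ∷_) (unique c gc)
  ... | no β≢b   with () ← trans (sym gc) (subst (λ β → g (β ∷ point subspace c) ≡ false)
                                                   (sym (¬-not β≢b)) (other-empty _))

double-≤-+ : ∀ {m n} → m ≤ n → 2 * m ≤ m + n
double-≤-+ {m} m≤n = +-monoʳ-≤ m (subst (_≤ _) (sym (+-identityʳ m)) m≤n)

isolate : ∀ {d} (g : F₂^ d → Bool) → 1 ≤ count g → IsolatingSubspace g
isolate {zero} g 1≤count with g [] in g[]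
... | true = record
  { subspace = affSub [] [] (λ { [] [] _ → refl })
  ; centre   = []
  ; centre∈  = g[]
  ; unique   = λ { [] _ → refl }
  ; large    = ≤-reflexive (cong (λ b → (if b then 1 else 0) * 1) (sym g[]))
  }
isolate {suc d} g 1≤count = halve (count g₀ ≟ 0) (count g₁ ≟ 0)
  where
  g₀ g₁ : F₂^ d → Bool
  g₀ = g ∘ (false ∷_)
  g₁ = g ∘ (true ∷_)
  halve : Dec (count g₀ ≡ 0) → Dec (count g₁ ≡ 0) → IsolatingSubspace g
  halve (yes c₀≡0) _ = isolating-freeHead g true (count≡0⇒false g₀ c₀≡0) (m≤n+m _ _)
    (isolate g₁ (subst (λ c₀ → 1 ≤ c₀ + count g₁) c₀≡0 1≤count))
  halve (no _) (yes c₁≡0) = isolating-freeHead g false (count≡0⇒false g₁ c₁≡0) (m≤m+n _ _)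
    (isolate g₀ (subst (1 ≤_) (trans (cong (count g₀ +_) c₁≡0) (+-identityʳ _)) 1≤count))
  halve (no c₀≢0) (no c₁≢0) with count g₀ ≤? count g₁
  ... | yes c₀≤c₁ = isolating-fixHead g false (double-≤-+ c₀≤c₁) (isolate g₀ (n≢0⇒n>0 c₀≢0))
  ... | no  c₀≰c₁ = isolating-fixHead g true
    (subst (2 * count g₁ ≤_) (+-comm (count g₁) (count g₀)) (double-≤-+ (≰⇒≥ c₀≰c₁)))
    (isolate g₁ (n≢0⇒n>0 c₁≢0))

countTrue-++ : ∀ (bs bs′ : List Bool) → countTrue (bs ++ bs′) ≡ countTrue bs + countTrue bs′
countTrue-++ []           bs′ = refl
countTrue-++ (true ∷ bs)  bs′ = cong suc (countTrue-++ bs bs′)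
countTrue-++ (false ∷ bs) bs′ = countTrue-++ bs bs′

countTrue-map-false : ∀ {A : Set} (xs : List A) → countTrue (List.map (λ _ → false) xs) ≡ 0
countTrue-map-false []       = refl
countTrue-map-false (x ∷ xs) = countTrue-map-false xs

countTrue-map-true : ∀ {A : Set} (p : A → Bool) (xs : List A) → (∀ x → p x ≡ true) →
  countTrue (List.map p xs) ≡ length xs
countTrue-map-true p []       p≡true = refl
countTrue-map-true p (x ∷ xs) p≡true with p x | p≡true x
... | true | refl = cong suc (countTrue-map-true p xs p≡true)

countTrue-+-not : ∀ {A : Set} (p : A → Bool) (xs : List A) →
  countTrue (List.map p xs) + countTrue (List.map (not ∘ p) xs) ≡ length xs
countTrue-+-not p []       = refl
countTrue-+-not p (x ∷ xs) with p x
... | true  = cong suc (countTrue-+-not p xs)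
... | false = trans (+-suc _ _) (cong suc (countTrue-+-not p xs))

any⇒1≤countTrue : ∀ {A : Set} (p : A → Bool) (xs : List A) → any p xs ≡ true →
  1 ≤ countTrue (List.map p xs)
any⇒1≤countTrue p (x ∷ xs) any≡true with p x
... | true  = s≤s z≤n
... | false = any⇒1≤countTrue p xs any≡true

any-∈ : ∀ {A : Set} (p : A → Bool) {x} {xs : List A} → x ∈ xs → p x ≡ true → any p xs ≡ true
any-∈ p {xs = _ ∷ xs} (here refl) px = cong (_∨ any p xs) px
any-∈ p {xs = y ∷ _} (there x∈xs) px = trans (cong (p y ∨_) (any-∈ p x∈xs px)) (∨-zeroʳ (p y))

not-any : ∀ {A : Set} (p : A → Bool) (xs : List A) → not (any p xs) ≡ all (not ∘ p) xs
not-any p []       = refl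
not-any p (x ∷ xs) with p x
... | true  = refl
... | false = not-any p xs

∈-allVecs : ∀ {d} (c : F₂^ d) → c ∈ allVecs d
∈-allVecs []          = here refl
∈-allVecs (false ∷ c) = ∈-concatMap⁺ _ (Any.map (λ { refl → here refl }) (∈-allVecs c))
∈-allVecs (true ∷ c)  = ∈-concatMap⁺ _ (Any.map (λ { refl → there (here refl) }) (∈-allVecs c))

bothHeads : ∀ {d} → F₂^ d → List (F₂^ (suc d))
bothHeads v = (false ∷ v) ∷ (true ∷ v) ∷ []

length-allVecs : ∀ d → length (allVecs d) ≡ 2 ^ d
length-allVecs zero    = refl
length-allVecs (suc d) = trans (length-concatMap-bothHeads (allVecs d)) (cong (2 *_) (length-allVecs d))
  where
  length-concatMap-bothHeads : (vs : List (F₂^ d)) → length (concatMap bothHeads vs) ≡ 2 * length vs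
  length-concatMap-bothHeads []       = refl
  length-concatMap-bothHeads (v ∷ vs) =
    trans (cong (2 +_) (length-concatMap-bothHeads vs)) (sym (*-suc 2 (length vs)))

countTrue-allVecs : ∀ {d} (g : F₂^ d → Bool) → countTrue (List.map g (allVecs d)) ≡ count g
countTrue-allVecs {zero} g with g []
... | true  = refl
... | false = refl
countTrue-allVecs {suc d} g = trans (countTrue-concatMap-bothHeads (allVecs d))
  (cong₂ _+_ (countTrue-allVecs (g ∘ (false ∷_))) (countTrue-allVecs (g ∘ (true ∷_))))
  where
  countTrue-concatMap-bothHeads : (vs : List (F₂^ d)) →
    countTrue (List.map g (concatMap bothHeads vs)) ≡
    countTrue (List.map (g ∘ (false ∷_)) vs) + countTrue (List.map (g ∘ (true ∷_)) vs)
  countTrue-concatMap-bothHeads []       = refl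
  countTrue-concatMap-bothHeads (v ∷ vs) with g (false ∷ v) | g (true ∷ v)
  ... | true  | true  = cong suc (trans (cong suc (countTrue-concatMap-bothHeads vs)) (sym (+-suc _ _)))
  ... | true  | false = cong suc (countTrue-concatMap-bothHeads vs)
  ... | false | true  = trans (cong suc (countTrue-concatMap-bothHeads vs)) (sym (+-suc _ _))
  ... | false | false = countTrue-concatMap-bothHeads vs

count+count∘not : ∀ {d} (g : F₂^ d → Bool) → count g + count (not ∘ g) ≡ 2 ^ d
count+count∘not {d} g = begin
  count g + count (not ∘ g)
    ≡⟨ cong₂ _+_ (countTrue-allVecs g) (countTrue-allVecs (not ∘ g)) ⟨
  countTrue (List.map g (allVecs d)) + countTrue (List.map (not ∘ g) (allVecs d))
    ≡⟨ countTrue-+-not g (allVecs d) ⟩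
  length (allVecs d)
    ≡⟨ length-allVecs d ⟩
  2 ^ d ∎
  where open ≡-Reasoning

any⇒1≤count : ∀ {d} (g : F₂^ d → Bool) → any g (allVecs d) ≡ true → 1 ≤ count g
any⇒1≤count {d} g any≡true = subst (1 ≤_) (countTrue-allVecs g) (any⇒1≤countTrue g (allVecs d) any≡true)

countTrue-∷ : ∀ b bs → countTrue (b ∷ bs) ≡ countTrue (b ∷ []) + countTrue bs
countTrue-∷ true  bs = refl
countTrue-∷ false bs = refl

countTrue-map-∧ˡ : ∀ {B : Set} (b : Bool) (q : B → Bool) (ys : List B) →
  countTrue (List.map (λ y → b ∧ q y) ys) ≡ countTrue (b ∷ []) * countTrue (List.map q ys)
countTrue-map-∧ˡ true  q ys = sym (+-identityʳ _)
countTrue-map-∧ˡ false q ys = countTrue-map-false ys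

countTrue-cartesian : ∀ {A B C : Set} (p : A → Bool) (q : B → Bool) (h : C → Bool)
  (_⊗_ : A → B → C) → (∀ x y → h (x ⊗ y) ≡ p x ∧ q y) → ∀ (xs : List A) (ys : List B) →
  countTrue (List.map h (concatMap (λ x → List.map (x ⊗_) ys) xs)) ≡
  countTrue (List.map p xs) * countTrue (List.map q ys)
countTrue-cartesian p q h _⊗_ h-⊗ []       ys = refl
countTrue-cartesian p q h _⊗_ h-⊗ (x ∷ xs) ys = begin
  countTrue (List.map h (List.map (x ⊗_) ys ++ rest))
    ≡⟨ cong countTrue (map-++ h (List.map (x ⊗_) ys) rest) ⟩
  countTrue (List.map h (List.map (x ⊗_) ys) ++ List.map h rest)
    ≡⟨ countTrue-++ (List.map h (List.map (x ⊗_) ys)) (List.map h rest) ⟩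
  countTrue (List.map h (List.map (x ⊗_) ys)) + countTrue (List.map h rest)
    ≡⟨ cong₂ _+_ (cong countTrue (trans (sym (map-∘ ys)) (map-cong (h-⊗ x) ys)))
                 (countTrue-cartesian p q h _⊗_ h-⊗ xs ys) ⟩
  countTrue (List.map (λ y → p x ∧ q y) ys) + P * Q
    ≡⟨ cong (_+ P * Q) (countTrue-map-∧ˡ (p x) q ys) ⟩
  countTrue (p x ∷ []) * Q + P * Q
    ≡⟨ *-distribʳ-+ Q (countTrue (p x ∷ [])) P ⟨
  (countTrue (p x ∷ []) + P) * Q
    ≡⟨ cong (_* Q) (countTrue-∷ (p x) (List.map p xs)) ⟨
  countTrue (List.map p (x ∷ xs)) * Q ∎
  where
  open ≡-Reasoning
  rest = concatMap (λ x → List.map (x ⊗_) ys) xs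
  P = countTrue (List.map p xs)
  Q = countTrue (List.map q ys)

module _ {A : Set} where

  length-allTuples : ∀ (xs : List A) T → length (allTuples xs T) ≡ length xs ^ T
  length-allTuples xs zero    = refl
  length-allTuples xs (suc T) =
    trans (length-prefixes xs) (cong (length xs *_) (length-allTuples xs T))
    where
    length-prefixes : (ys : List A) →
      length (concatMap (λ y → List.map (y ∷_) (allTuples xs T)) ys) ≡ length ys * length (allTuples xs T)
    length-prefixes []       = refl
    length-prefixes (y ∷ ys) = trans (length-++ (List.map (y ∷_) (allTuples xs T)))
      (cong₂ _+_ (length-map (y ∷_) (allTuples xs T)) (length-prefixes ys))

  countTrue-allTuples : ∀ (p : A → Bool) (xs : List A) T →
    countTrue (List.map (all p ∘ toList) (allTuples xs T)) ≡ countTrue (List.map p xs) ^ T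
  countTrue-allTuples p xs zero    = refl
  countTrue-allTuples p xs (suc T) =
    trans (countTrue-cartesian p (all p ∘ toList) (all p ∘ toList) _∷_ (λ _ _ → refl) xs (allTuples xs T))
          (cong (countTrue (List.map p xs) *_) (countTrue-allTuples p xs T))

binomial-lower-bound : ∀ m k → m ^ suc k + suc k * m ^ k ≤ suc m ^ suc k
binomial-lower-bound m zero    = ≤-reflexive (+-comm (m * 1) 1)
binomial-lower-bound m (suc k) = begin
  m ^ suc (suc k) + suc (suc k) * m ^ suc k
    ≤⟨ m≤m+n _ (suc k * m ^ k) ⟩
  m ^ suc (suc k) + suc (suc k) * m ^ suc k + suc k * m ^ k
    ≡⟨ expand m (m ^ k) k ⟩
  suc m * (m ^ suc k + suc k * m ^ k)
    ≤⟨ *-monoʳ-≤ (suc m) (binomial-lower-bound m k) ⟩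
  suc m * suc m ^ suc k ∎
  where
  open ≤-Reasoning
  expand : ∀ m x k → m * (m * x) + (2 + k) * (m * x) + (1 + k) * x ≡ (1 + m) * (m * x + (1 + k) * x)
  expand = solve-∀

2*m^[1+m]≤[1+m]^[1+m] : ∀ m → 2 * m ^ suc m ≤ suc m ^ suc m
2*m^[1+m]≤[1+m]^[1+m] m = ≤-trans
  (+-monoʳ-≤ (m ^ suc m) (subst (_≤ suc m * m ^ m) (sym (+-identityʳ _)) (m≤n+m (m ^ suc m) (m ^ m))))
  (binomial-lower-bound m m)

3*m^T≤[1+m]^T : ∀ m T → 2 * suc m ≤ T → 3 * m ^ T ≤ suc m ^ T
3*m^T≤[1+m]^T m T 2q≤T =
  subst (λ T → 3 * m ^ T ≤ q ^ T) (m∸n+n≡m (subst (_≤ T) (cong (q +_) (+-identityʳ q)) 2q≤T))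
    (beyond (T ∸ (q + q)))
  where
  q = suc m
  open ≤-Reasoning
  beyond : ∀ r → 3 * m ^ (r + (q + q)) ≤ q ^ (r + (q + q))
  beyond zero = begin
    3 * m ^ (q + q)         ≤⟨ *-monoˡ-≤ (m ^ (q + q)) (n≤1+n 3) ⟩
    4 * m ^ (q + q)         ≡⟨ cong (4 *_) (^-distribˡ-+-* m q q) ⟩
    4 * (m ^ q * m ^ q)     ≡⟨ *-interchange 2 2 (m ^ q) (m ^ q) ⟩
    (2 * m ^ q) * (2 * m ^ q) ≤⟨ *-mono-≤ (2*m^[1+m]≤[1+m]^[1+m] m) (2*m^[1+m]≤[1+m]^[1+m] m) ⟩
    q ^ q * q ^ q           ≡⟨ ^-distribˡ-+-* q q q ⟨
    q ^ (q + q)             ∎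
  beyond (suc r) = begin
    3 * (m * m ^ (r + (q + q))) ≡⟨ x∙yz≈y∙xz 3 m (m ^ (r + (q + q))) ⟩
    m * (3 * m ^ (r + (q + q))) ≤⟨ *-mono-≤ (n≤1+n m) (beyond r) ⟩
    q * q ^ (r + (q + q))       ∎

^-distribʳ-* : ∀ x y n → (x * y) ^ n ≡ x ^ n * y ^ n
^-distribʳ-* x y zero    = refl
^-distribʳ-* x y (suc n) = trans (cong (x * y *_) (^-distribʳ-* x y n)) (*-interchange x y (x ^ n) (y ^ n))

-- qB ≤ mL says B/L ≤ 1 − 1/q; then (1 − 1/q)ᵀ ≤ 1/3 is 3*m^T≤[1+m]^T.
rare-misses : ∀ {S B L} q T → 1 ≤ q → S + B ≡ L → L ≤ S * q → 2 * q ≤ T → 3 * B ^ T ≤ L ^ T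
rare-misses {S} {B} {L} (suc m) T _ S+B≡L L≤Sq 2q≤T = *-cancelˡ-≤ (q ^ T) {{m^n≢0 q T}} (begin
  q ^ T * (3 * B ^ T) ≡⟨ x∙yz≈y∙xz (q ^ T) 3 (B ^ T) ⟩
  3 * (q ^ T * B ^ T) ≡⟨ cong (3 *_) (^-distribʳ-* q B T) ⟨
  3 * (q * B) ^ T     ≤⟨ *-monoʳ-≤ 3 (^-monoˡ-≤ T qB≤mL) ⟩
  3 * (m * L) ^ T     ≡⟨ cong (3 *_) (^-distribʳ-* m L T) ⟩
  3 * (m ^ T * L ^ T) ≡⟨ *-assoc 3 (m ^ T) (L ^ T) ⟨
  3 * m ^ T * L ^ T   ≤⟨ *-monoˡ-≤ (L ^ T) (3*m^T≤[1+m]^T m T 2q≤T) ⟩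
  q ^ T * L ^ T       ∎)
  where
  q = suc m
  open ≤-Reasoning
  qB≤mL : q * B ≤ m * L
  qB≤mL = +-cancelʳ-≤ L (q * B) (m * L) (begin
    q * B + L     ≤⟨ +-monoʳ-≤ (q * B) L≤Sq ⟩
    q * B + S * q ≡⟨ regroup q B S ⟩
    q * (S + B)   ≡⟨ cong (q *_) S+B≡L ⟩
    q * L         ≡⟨ +-comm L (m * L) ⟩
    m * L + L     ∎)
    where
    regroup : ∀ q B S → q * B + S * q ≡ q * (S + B)
    regroup = solve-∀

two-thirds : ∀ {Y Z N} → Y + Z ≡ N → 3 * Z ≤ N → 2 * N ≤ 3 * Y
two-thirds {Y} {Z} {N} Y+Z≡N 3Z≤N = +-cancelʳ-≤ (3 * Z) (2 * N) (3 * Y) (begin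
  2 * N + 3 * Z ≤⟨ +-monoʳ-≤ (2 * N) 3Z≤N ⟩
  2 * N + N     ≡⟨ +-comm (2 * N) N ⟩
  3 * N         ≡⟨ cong (3 *_) Y+Z≡N ⟨
  3 * (Y + Z)   ≡⟨ *-distribˡ-+ 3 Y Z ⟩
  3 * Y + 3 * Z ∎)
  where open ≤-Reasoning

⌊⌋-complete : ∀ {P : Set} (p? : Dec P) → P → ⌊ p? ⌋ ≡ true
⌊⌋-complete p? p = trans (isYes≗does p?) (dec-true p? p)

⌊⌋-sound : ∀ {P : Set} (p? : Dec P) → ⌊ p? ⌋ ≡ true → P
⌊⌋-sound p? ⌊p?⌋ = toWitness {a? = p?} (Equivalence.from T-≡ ⌊p?⌋)

hamCong?-sound : ∀ {n} M a (x : F₂^ n) → hamCong? M a x ≡ true → HamCong M a x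
hamCong?-sound M a x = ∣⇒∣ᵤ ∘ ⌊⌋-sound (_ ∣? _)

hamCong?-complete : ∀ {n} M a (x : F₂^ n) → HamCong M a x → hamCong? M a x ≡ true
hamCong?-complete M a x = ⌊⌋-complete (_ ∣? _) ∘ ∣ᵤ⇒∣

∣-minus-trans : ∀ {k x y z} → k ∣ (x - y) → k ∣ (y - z) → k ∣ (x - z)
∣-minus-trans {x = x} {y} {z} k∣x-y k∣y-z =
  subst (_ ∣_) (+-minus-telescope x y z) (∣m∣n⇒∣m+n k∣x-y k∣y-z)

HamCong-shift : ∀ {n M b b′} (x : F₂^ n) → ℤ.+ M ∣ (b - b′) → HamCong M b x → HamCong M b′ x
HamCong-shift {M = M} {b} {b′} x b≅b′ x≅b =
  ∣⇒∣ᵤ (∣-minus-trans {ℤ.+ M} {ℤ.+ Ham x} {b} {b′} (∣ᵤ⇒∣ x≅b) b≅b′)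

module _ (M : ℕ) .{{_ : NonZero M}} (a : ℤ) where

  private
    r = ℤ.+ (a %ℕ M)
    q = a /ℕ M

  ∣-minus-%ℕ : ℤ.+ M ∣ (a - r)
  ∣-minus-%ℕ = divides q (trans (cong (_- r) (a≡a%ℕn+[a/ℕn]*n a M)) (cancel r q (ℤ.+ M)))
    where
    cancel : ∀ r q m → (r ℤ.+ q ℤ.* m) - r ≡ q ℤ.* m
    cancel = ℤ-Solver.solve-∀

  ∣-%ℕ-minus : ℤ.+ M ∣ (r - a)
  ∣-%ℕ-minus = divides (ℤ.- q) (trans (cong (r -_) (a≡a%ℕn+[a/ℕn]*n a M)) (cancel r q (ℤ.+ M)))
    where
    cancel : ∀ r q m → r - (r ℤ.+ q ℤ.* m) ≡ (ℤ.- q) ℤ.* m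
    cancel = ℤ-Solver.solve-∀

  ExactlyOne-%ℕ : ∀ {n d} {C : AffSub n d} → ExactlyOne M a C → ExactlyOne M r C
  ExactlyOne-%ℕ (x , (x∈C , x≅a) , unique) =
    x , (x∈C , HamCong-shift {M = M} {a} {r} x ∣-minus-%ℕ x≅a) ,
    λ y y∈C y≅r → unique y y∈C (HamCong-shift {M = M} {r} {a} y ∣-%ℕ-minus y≅r)

module _ {n d : ℕ} (M : ℕ) (V : AffSub n d) (a : ℤ) where

  solution? : F₂^ d → Bool
  solution? c = hamCong? M a (point V c)

  hit : ∀ {T} → Vec (F₂^ d) T → Bool
  hit s = any solution? (toList s)

  mem?-point : ∀ c → mem? V (point V c) ≡ true
  mem?-point c = any-∈ _ (∈-allVecs c) (⌊⌋-complete (≡-dec Bool._≟_ (point V c) (point V c)) refl)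

  correct?-algorithm : ∀ {T} (s : Vec (F₂^ d) T) →
    correct? M V a (algorithm M V a s) ≡ hit s ∨ not (hasSol? M V a)
  correct?-algorithm []      = refl
  correct?-algorithm (c ∷ s) with solution? c in solution-c
  ... | true  = cong₂ _∧_ (mem?-point c) solution-c
  ... | false = correct?-algorithm s

  numCorrect-noSolution : ∀ T → hasSol? M V a ≡ false → numCorrect M V a T ≡ (2 ^ d) ^ T
  numCorrect-noSolution T no-solution = begin
    numCorrect M V a T                   ≡⟨ countTrue-map-true _ (allTuples (allVecs d) T) always-correct ⟩
    length (allTuples (allVecs d) T)     ≡⟨ length-allTuples (allVecs d) T ⟩
    length (allVecs d) ^ T               ≡⟨ cong (_^ T) (length-allVecs d) ⟩
    (2 ^ d) ^ T                          ∎
    where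
    open ≡-Reasoning
    always-correct : ∀ (s : Vec (F₂^ d) T) → correct? M V a (algorithm M V a s) ≡ true
    always-correct s = trans (correct?-algorithm s)
      (trans (cong (λ b → hit s ∨ not b) no-solution) (∨-zeroʳ (hit s)))

  numCorrect-solution : ∀ T → hasSol? M V a ≡ true →
    numCorrect M V a T + count (not ∘ solution?) ^ T ≡ (2 ^ d) ^ T
  numCorrect-solution T solution = begin
    numCorrect M V a T + count (not ∘ solution?) ^ T
      ≡⟨ cong₂ _+_ (cong countTrue (map-cong correct⇔hit tuples))
                   (trans (cong (_^ T) (sym (countTrue-allVecs (not ∘ solution?))))
                          (sym (countTrue-allTuples (not ∘ solution?) (allVecs d) T))) ⟩
    countTrue (List.map hit tuples) + countTrue (List.map (all (not ∘ solution?) ∘ toList) tuples)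
      ≡⟨ cong (λ k → countTrue (List.map hit tuples) + countTrue k)
              (map-cong (λ s → sym (not-any solution? (toList s))) tuples) ⟩
    countTrue (List.map hit tuples) + countTrue (List.map (not ∘ hit) tuples)
      ≡⟨ countTrue-+-not hit tuples ⟩
    length tuples
      ≡⟨ length-allTuples (allVecs d) T ⟩
    length (allVecs d) ^ T
      ≡⟨ cong (_^ T) (length-allVecs d) ⟩
    (2 ^ d) ^ T ∎
    where
    open ≡-Reasoning
    tuples = allTuples (allVecs d) T
    correct⇔hit : ∀ (s : Vec (F₂^ d) T) → correct? M V a (algorithm M V a s) ≡ hit s
    correct⇔hit s = trans (correct?-algorithm s)
      (trans (cong (λ b → hit s ∨ not b) solution) (∨-identityʳ (hit s)))

  exactlyOne-restrict : (I : IsolatingSubspace solution?) →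
    ExactlyOne M a (restrict V (IsolatingSubspace.subspace I))
  exactlyOne-restrict I =
    point V (point K centre) ,
    ((centre , point-restrict V K centre) , hamCong?-sound M a (point V (point K centre)) centre∈) ,
    λ { _ (c , refl) y≅a → trans (point-restrict V K c) (cong (point V) (unique c (gc y≅a))) }
    where
    open IsolatingSubspace I renaming (subspace to K)
    gc : ∀ {c} → HamCong M a (point (restrict V K) c) → solution? (point K c) ≡ true
    gc {c} y≅a = hamCong?-complete M a (point V (point K c)) (subst (HamCong M a) (point-restrict V K c) y≅a)

  -- 𝒟(n,M) only ranges over residues 0 ≤ a ≤ M, hence the reduction of a mod M.
  dim≤𝒟 : .{{_ : NonZero M}} → ∀ {D} → IsDmax n M D → (I : IsolatingSubspace solution?) →
    IsolatingSubspace.dim I ≤ D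
  dim≤𝒟 (_ , maximal) I = maximal dim (restrict V subspace) (a %ℕ M) (<⇒≤ (n%ℕd<d a M))
    (ExactlyOne-%ℕ M a {C = restrict V subspace} (exactlyOne-restrict I))
    where open IsolatingSubspace I

corollary4p7 : (n M : ℕ) → 1 ≤ n → 1 ≤ M → (D : ℕ) → IsDmax n M D →
    (T : ℕ) → 4 * 2 ^ D ≤ T →
    (d : ℕ) (V : AffSub n d) (a : ℤ) →
    2 * (2 ^ d) ^ T ≤ 3 * numCorrect M V a T
corollary4p7 n zero      _ () D 𝒟 T 4·2ᴰ≤T d V a
corollary4p7 n M@(suc _) _ _  D 𝒟 T 4·2ᴰ≤T d V a = by-cases (hasSol? M V a) refl
  where
  by-cases : ∀ b → hasSol? M V a ≡ b → 2 * (2 ^ d) ^ T ≤ 3 * numCorrect M V a T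
  by-cases false no-solution rewrite numCorrect-noSolution M V a T no-solution =
    *-monoˡ-≤ ((2 ^ d) ^ T) (n≤1+n 2)
  by-cases true solution =
    two-thirds {numCorrect M V a T} (numCorrect-solution M V a T solution)
      (rare-misses (2 ^ D) T (m^n>0 2 D) (count+count∘not (solution? M V a)) 2ᵈ≤#solutions·2ᴰ
        (≤-trans (*-monoˡ-≤ (2 ^ D) {2} {4} (s≤s (s≤s z≤n))) 4·2ᴰ≤T))
    where
    I = isolate (solution? M V a) (any⇒1≤count (solution? M V a) solution)
    2ᵈ≤#solutions·2ᴰ : 2 ^ d ≤ count (solution? M V a) * 2 ^ D
    2ᵈ≤#solutions·2ᴰ = ≤-trans (IsolatingSubspace.large I)
      (*-monoʳ-≤ (count (solution? M V a)) (^-monoʳ-≤ 2 (dim≤𝒟 M V a 𝒟 I)))
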